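{- Let $T$ be an h-inductive theory in a first-order language $L$. If the class $\Sigma_T$ of h-maximal models of $T$ is elementary, then the class $\Sigma_{T_k(T)}$ of h-maximal models of $T_k(T)$ is elementary and is axiomatized by $T_k(T)$ (i.e., every model of $T_k(T)$ is an h-maximal model of $T_k(T)$).
   Context: Positive logic. A positive formula is one built from atomic formulas using $\wedge$, $\vee$ and $\exists$. An h-inductive sentence is a finite conjunction of sentences $\forall\bar x\,(\exists\bar y\,\psi(\bar x,\bar y)\rightarrow\exists\bar z\,\varphi(\bar x,\bar z))$ with $\psi,\varphi$ quantifier-free positive; an h-inductive theory is a set of such sentences. A homomorphism of $L$-structures preserves atomic formulas; it is an embedding if it preserves and reflects atomic formulas, and an immersion if it preserves and reflects positive formulas. A model $M$ of an h-inductive theory $S$ is h-maximal (for $S$) if every homomorphism from $M$ into a model of $S$ is an embedding, and positively closed (pc) if every such homomorphism is an immersion. $T_k(T)$ is the set of h-inductive $L$-sentences true in every pc model of $T$. A class of $L$-structures is elementary if it is the class of all models of some h-inductive $L$-theory. -}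

module Defs where

open import Data.Nat using (ℕ; suc; _+_)
open import Data.Fin using (Fin)
open import Data.List using (List)
open import Data.List.Relation.Unary.All using (All)
open import Data.Product using (Σ; ∃; _×_)
open import Data.Sum using (_⊎_)
open import Data.Unit.Polymorphic using (⊤)
open import Data.Empty.Polymorphic using (⊥)
open import Data.Vec.Functional using (Vector; _++_; _∷_)
open import Function using (_∘_)
open import Relation.Binary.PropositionalEquality using (_≡_)
open import Level using (0ℓ)

record Lang : Set₁ where
  field
    Func  : Set
    farity : Func → ℕ
    Rel   : Set
    rarity : Rel → ℕ

module _ (L : Lang) where
  open Lang L

  data Term (n : ℕ) : Set where
    var : Fin n → Term n
    app : (f : Func) → (Fin (farity f) → Term n) → Term n

  data Atomic (n : ℕ) : Set where
    at⊤ at⊥ : Atomic n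
    _≐_ : Term n → Term n → Atomic n
    rel : (R : Rel) → (Fin (rarity R) → Term n) → Atomic n

  data QFPos (n : ℕ) : Set where
    atom : Atomic n → QFPos n
    _∧_ _∨_ : QFPos n → QFPos n → QFPos n

  data Pos (n : ℕ) : Set where
    atom : Atomic n → Pos n
    _∧_ _∨_ : Pos n → Pos n → Pos n
    ex : Pos (suc n) → Pos n

  -- basic h-inductive sentence  ∀x̄ (∃ȳ ψ(x̄,ȳ) → ∃z̄ φ(x̄,z̄))
  record BasicHInd : Set where
    constructor hind
    field
      nx ny nz : ℕ
      ψ : QFPos (nx + ny)
      φ : QFPos (nx + nz)

  -- h-inductive sentence: a finite conjunction of basic ones
  HSent : Set
  HSent = List BasicHInd

  Theory : Set₂
  Theory = HSent → Set₁

  record Str : Set₁ where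
    field
      Carrier : Set
      fun : (f : Func) → (Fin (farity f) → Carrier) → Carrier
      relS : (R : Rel) → (Fin (rarity R) → Carrier) → Set

  module _ (M : Str) where
    open Str M

    evalT : ∀ {n} → Term n → Vector Carrier n → Carrier
    evalT (var i) a = a i
    evalT (app f ts) a = fun f (λ i → evalT (ts i) a)

    satA : ∀ {n} → Atomic n → Vector Carrier n → Set
    satA at⊤ a = ⊤
    satA at⊥ a = ⊥
    satA (s ≐ t) a = evalT s a ≡ evalT t a
    satA (rel R ts) a = relS R (λ i → evalT (ts i) a)

    satQ : ∀ {n} → QFPos n → Vector Carrier n → Set
    satQ (atom α) a = satA α a
    satQ (φ ∧ ψ) a = satQ φ a × satQ ψ a
    satQ (φ ∨ ψ) a = satQ φ a ⊎ satQ ψ a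

    satP : ∀ {n} → Pos n → Vector Carrier n → Set
    satP (atom α) a = satA α a
    satP (φ ∧ ψ) a = satP φ a × satP ψ a
    satP (φ ∨ ψ) a = satP φ a ⊎ satP ψ a
    satP (ex φ) a = Σ Carrier λ b → satP φ (b ∷ a)

    satB : BasicHInd → Set
    satB (hind nx ny nz ψ φ) =
      (a : Vector Carrier nx) →
      (Σ (Vector Carrier ny) λ b → satQ ψ (a ++ b)) →
      Σ (Vector Carrier nz) λ c → satQ φ (a ++ c)

    _⊨_ : HSent → Set
    _⊨_ σ = All satB σ

  Model : Theory → Str → Set₁
  Model T M = ∀ σ → T σ → M ⊨ σ

  module _ {M N : Str} (h : Str.Carrier M → Str.Carrier N) where
    IsHom : Set
    IsHom = ∀ {n} (α : Atomic n) (a : Vector (Str.Carrier M) n) →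
            satA M α a → satA N α (h ∘ a)

    IsEmbedding : Set
    IsEmbedding = IsHom × (∀ {n} (α : Atomic n) (a : Vector (Str.Carrier M) n) →
                           satA N α (h ∘ a) → satA M α a)

    IsImmersion : Set
    IsImmersion =
      (∀ {n} (φ : Pos n) (a : Vector (Str.Carrier M) n) → satP M φ a → satP N φ (h ∘ a)) ×
      (∀ {n} (φ : Pos n) (a : Vector (Str.Carrier M) n) → satP N φ (h ∘ a) → satP M φ a)

  HMaximal : Theory → Str → Set₁
  HMaximal S M = Model S M ×
    ((N : Str) → Model S N → (h : Str.Carrier M → Str.Carrier N) →
      IsHom {M} {N} h → IsEmbedding {M} {N} h)

  PC : Theory → Str → Set₁
  PC S M = Model S M ×
    ((N : Str) → Model S N → (h : Str.Carrier M → Str.Carrier N) →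
      IsHom {M} {N} h → IsImmersion {M} {N} h)

  Tk : Theory → Theory
  Tk T σ = (M : Str) → PC T M → M ⊨ σ

  Elementary : (Str → Set₁) → Set₂
  Elementary C = Σ Theory λ S → (M : Str) → (Model S M → C M) × (C M → Model S M)

module Submission where

-- Let S be an h-inductive theory whose models are
-- exactly the h-maximal models of T.
--   * A positively closed model is h-maximal: an immersion reflects the
--     atomic formulas, so it is an embedding.  Hence every pc model of T
--     satisfies S, i.e. S ⊆ T_k(T).
--   * Consequently every model of T_k(T) is a model of S, so it is an
--     h-maximal model of T; in particular every model of T_k(T) is a
--     model of T.
--   * h-maximality passes to a stronger theory: if M is h-maximal for T,
--     every model of S' is a model of T and M ⊨ S', then M is h-maximal
--     for S' (there are fewer targets for homomorphisms).
-- Applying the last point with S' = T_k(T) shows that every model of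
-- T_k(T) is h-maximal for T_k(T), so T_k(T) axiomatizes that class.

open import Defs
open import Data.Product using (_×_; _,_; proj₁; proj₂)

module _ (L : Lang) where

  _⊆Mod_ : Theory L → Theory L → Set₁
  S' ⊆Mod S = (M : Str L) → Model L S' M → Model L S M

  -- An immersion reflects positive formulas, in particular atomic ones,
  -- so a positively closed model is h-maximal.
  pc⇒hMaximal : (T : Theory L) (M : Str L) → PC L T M → HMaximal L T M
  pc⇒hMaximal T M (M⊨T , immerse) = M⊨T , λ N N⊨T h hom →
    hom , λ α a → proj₂ (immerse N N⊨T h hom) (atom α) a

  trueInHMaximal⇒⊆Tk : (T S : Theory L) →
    ((M : Str L) → HMaximal L T M → Model L S M) →
    ∀ σ → S σ → Tk L T σ
  trueInHMaximal⇒⊆Tk T S hmax⊨S σ σ∈S M pc =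
    hmax⊨S M (pc⇒hMaximal T M pc) σ σ∈S

  modelOfSubtheory : (S S' : Theory L) → (∀ σ → S σ → S' σ) → S' ⊆Mod S
  modelOfSubtheory S S' S⊆S' M M⊨S' σ σ∈S = M⊨S' σ (S⊆S' σ σ∈S)

  -- h-maximality for T transfers to any theory S' all of whose models
  -- are models of T: homomorphisms into models of S' go into models of T.
  hMaximal-strengthen : (T S' : Theory L) → S' ⊆Mod T →
    (M : Str L) → Model L S' M → HMaximal L T M → HMaximal L S' M
  hMaximal-strengthen T S' S'⊆T M M⊨S' (_ , embed) =
    M⊨S' , λ N N⊨S' → embed N (S'⊆T N N⊨S')

mainTheorem9 : (L : Lang) (T : Theory L) →
    Elementary L (HMaximal L T) →
    Elementary L (HMaximal L (Tk L T)) ×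
    ((M : Str L) → Model L (Tk L T) M → HMaximal L (Tk L T) M)
mainTheorem9 L T (S , S-axiomatizes) = (Tk L T , λ M → Tk⇒hMax M , proj₁) , Tk⇒hMax
  where
  S⊆Tk : ∀ σ → S σ → Tk L T σ
  S⊆Tk = trueInHMaximal⇒⊆Tk L T S λ M → proj₂ (S-axiomatizes M)

  Tk⇒hMaxT : (M : Str L) → Model L (Tk L T) M → HMaximal L T M
  Tk⇒hMaxT M M⊨Tk = proj₁ (S-axiomatizes M) (modelOfSubtheory L S (Tk L T) S⊆Tk M M⊨Tk)

  Tk⇒hMax : (M : Str L) → Model L (Tk L T) M → HMaximal L (Tk L T) M
  Tk⇒hMax M M⊨Tk = hMaximal-strengthen L T (Tk L T)
    (λ N N⊨Tk → proj₁ (Tk⇒hMaxT N N⊨Tk)) M M⊨Tk (Tk⇒hMaxT M M⊨Tk)
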